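{- Let $K = \langle S, AP, \to, L\rangle$ be a Kripke structure. For all states $s, s' \in S$: $s$ and $s'$ are trace equivalent in $K$ if and only if $s$ and $s'$ are completed trace equivalent in the labelled transition system $\mathsf{lts}(K)$.
   Context: A Kripke structure is $K=\langle S, AP, \to, L\rangle$ with $S$ a set of states, $AP$ a set of atomic propositions, $\to\,\subseteq S\times S$ a total transition relation (for every $s\in S$ there is $t\in S$ with $s\to t$), and $L: S\to 2^{AP}$ a state labelling. A labelled transition system (LTS) is $T=\langle S, Act, \to\rangle$ with $S$ a set of states, $Act$ a set of actions, a special silent action $\tau\notin Act$, and a transition relation $\to\,\subseteq S\times(Act\cup\{\tau\})\times S$ that is total (for every $s\in S$ there are $a\in Act$, $t\in S$ with $s\xrightarrow{a}t$). The embedding $\mathsf{lts}$: for a Kripke structure $K=\langle S,AP,\to,L\rangle$, $\mathsf{lts}(K)=\langle S', Act, \to'\rangle$ where $S' = S\cup\{\bar s \mid s\in S\}$ (each $\bar s$ a fresh state not in $S$), $Act = 2^{AP}\cup\{\bot\}$ with $\bot$ a fresh symbol, and $\to'$ is the smallest relation such that: $s\xrightarrow{\bot}\bar s$ for every $s\in S$; $\bar s\xrightarrow{L(s)} s$ for every $s\in S$; $s\xrightarrow{\tau}t$ whenever $s\to t$ and $L(s)=L(t)$; $s\xrightarrow{L(t)}t$ whenever $s\to t$ and $L(s)\neq L(t)$. Trace equivalence in a Kripke structure: a path from $s$ is an infinite sequence $s_0 s_1\ldots$ of states with $s_0=s$ and $s_i\to s_{i+1}$ for all $i$; its trace is the infinite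 sequence $L(s_0)L(s_1)\ldots$; states $s,s'$ are trace equivalent iff the set of traces of paths from $s$ equals the set of traces of paths from $s'$. Completed trace equivalence in an LTS: a run from $s$ is an infinite alternating sequence $s_0 a_0 s_1 a_1\ldots$ with $s_0=s$ and $s_i\xrightarrow{a_i}s_{i+1}$ for all $i$ (the $a_i$ range over $Act\cup\{\tau\}$); its trace is the infinite sequence $a_0a_1\ldots$ (with $\tau$'s included); states $s,s'$ are completed trace equivalent iff the set of traces of runs from $s$ equals the set of traces of runs from $s'$. -}

module Defs where

open import Data.Nat using (ℕ; suc)
open import Data.Bool using (Bool)
open import Data.Product using (Σ; ∃; ∃₂; _×_; _,_)
open import Data.Sum using (_⊎_; inj₁; inj₂)
open import Relation.Binary.PropositionalEquality using (_≡_; _≢_)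
open import Function.Bundles using (_⇔_)

-- 2^AP : subsets of AP, represented by characteristic functions.
Subset : Set → Set
Subset AP = AP → Bool

record Kripke : Set₁ where
  field
    S     : Set
    AP    : Set
    _⟶_   : S → S → Set
    total : ∀ s → ∃ λ t → s ⟶ t
    L     : S → Subset AP

module _ (K : Kripke) where
  open Kripke K

  IsPath : S → (ℕ → S) → Set
  IsPath s p = (p 0 ≡ s) × (∀ i → p i ⟶ p (suc i))

  IsTrace : S → (ℕ → Subset AP) → Set
  IsTrace s σ = ∃ λ p → IsPath s p × (∀ i → L (p i) ≡ σ i)

  TraceEquivalent : S → S → Set
  TraceEquivalent s s' = ∀ σ → IsTrace s σ ⇔ IsTrace s' σ

data Act⁺ (A : Set) : Set where
  τ   : Act⁺ A
  act : A → Act⁺ A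

record LTS : Set₁ where
  field
    State  : Set
    Act    : Set
    _—[_]→_ : State → Act⁺ Act → State → Set
    total  : ∀ s → ∃₂ λ a t → s —[ act a ]→ t

module _ (T : LTS) where
  open LTS T

  -- σ is the trace of some run from s (a run s₀ a₀ s₁ a₁ … ; its trace is a₀ a₁ …)
  IsRunTrace : State → (ℕ → Act⁺ Act) → Set
  IsRunTrace s σ = ∃ λ (p : ℕ → State) → (p 0 ≡ s) × (∀ i → p i —[ σ i ]→ p (suc i))

  CompletedTraceEquivalent : State → State → Set
  CompletedTraceEquivalent s s' = ∀ σ → IsRunTrace s σ ⇔ IsRunTrace s' σ

data KAct (AP : Set) : Set where
  ⊥act : KAct AP
  lab  : Subset AP → KAct AP

module Embedding (K : Kripke) where
  open Kripke K

  -- S' = S ∪ {s̄ | s ∈ S}: inj₁ s is s, inj₂ s is s̄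
  S' : Set
  S' = S ⊎ S

  data Step : S' → Act⁺ (KAct AP) → S' → Set where
    to-bar   : ∀ s → Step (inj₁ s) (act ⊥act) (inj₂ s)
    from-bar : ∀ s → Step (inj₂ s) (act (lab (L s))) (inj₁ s)
    silent   : ∀ {s t} → s ⟶ t → L s ≡ L t → Step (inj₁ s) τ (inj₁ t)
    visible  : ∀ {s t} → s ⟶ t → L s ≢ L t → Step (inj₁ s) (act (lab (L t))) (inj₁ t)

  Step-total : ∀ x → ∃₂ λ a y → Step x (act a) y
  Step-total (inj₁ s) = ⊥act , inj₂ s , to-bar s
  Step-total (inj₂ s) = lab (L s) , inj₁ s , from-bar s

lts : Kripke → LTS
lts K = record
  { State   = Embedding.S' K
  ; Act     = KAct (Kripke.AP K)
  ; _—[_]→_ = Embedding.Step K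
  ; total   = Embedding.Step-total K
  }

module Submission where

-- * A K-path with trace σ yields a run of lts(K) from the same state whose
--   trace `encode σ` is determined by σ alone: first ⊥ and the initial label
--   (a detour through the barred state), then for every edge either τ or the
--   new label.  Conversely, any run with trace `encode σ` is forced by the
--   shape of the transitions to trace out a K-path with trace σ.  Hence
--   completed trace inclusion implies trace inclusion.
--
-- * An arbitrary run of lts(K) projects to a *stuttering* K-path: every step
--   is a K-edge or leaves the underlying state unchanged.  Removing the
--   stutters (classically, as the run may make only finitely many K-steps)
--   gives a K-path; a K-path with the same labels from the other state,
--   re-stuttered in the same pattern, reproduces the run's trace, because
--   lts(K) sees K-states only through their labels and edges.  Hence trace
--   inclusion implies completed trace inclusion.

open import Defs
open import Data.Bool using (Bool; true; false; if_then_else_)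
open import Data.Nat using (ℕ; zero; suc; _+_; _≤_; _≤′_; ≤′-refl; ≤′-step)
open import Data.Nat.Properties using (≤-refl; ≤-trans; ≤-total; n≤1+n; 1+n≰n; suc-injective; ≤⇒≤′)
open import Data.Product using (∃; _×_; _,_; proj₁; proj₂)
open import Data.Sum using (inj₁; inj₂)
open import Data.Empty using (⊥; ⊥-elim)
open import Function using (_∘_)
open import Function.Bundles using (_⇔_; mk⇔; Equivalence)
open import Relation.Nullary using (Dec; yes; no)
open import Relation.Binary.PropositionalEquality
open import Axiom.ExcludedMiddle using (ExcludedMiddle)
open import Axiom.Extensionality.Propositional using (Extensionality)
open import Level using (0ℓ)

-- Stuttering paths over an arbitrary relation _⇒_: a step pattern b marks
-- which steps are moves along _⇒_ (true) and which repeat the state (false).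
module Stuttering {A : Set} (_⇒_ : A → A → Set) where

  StutterStep : Bool → A → A → Set
  StutterStep true  a a' = a ⇒ a'
  StutterStep false a a' = a' ≡ a

  moves : (ℕ → Bool) → ℕ → ℕ
  moves b zero    = zero
  moves b (suc n) = if b n then suc (moves b n) else moves b n

  moves-mono : ∀ b {m n} → m ≤′ n → moves b m ≤ moves b n
  moves-mono b ≤′-refl = ≤-refl
  moves-mono b {m} (≤′-step {n} m≤′n) with b n
  ... | true  = ≤-trans (moves-mono b m≤′n) (n≤1+n _)
  ... | false = moves-mono b m≤′n

  moves-advance : ∀ b {n} → b n ≡ true → moves b (suc n) ≡ suc (moves b n)
  moves-advance b moved rewrite moved = refl

  sample : ∀ {q : ℕ → A} → (∀ k → q k ⇒ q (suc k)) →
           ∀ b n → StutterStep (b n) (q (moves b n)) (q (moves b (suc n)))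
  sample path b n with b n
  ... | true  = path (moves b n)
  ... | false = refl

  -- Whether the
  -- path makes a (k+1)-st move is decided by excluded middle; if it never does,
  -- the path is continued arbitrarily using seriality of _⇒_.
  module Destutter (em : ExcludedMiddle 0ℓ) (serial : ∀ a → ∃ λ a' → a ⇒ a')
                   (b : ℕ → Bool) (u : ℕ → A)
                   (stutters : ∀ n → StutterStep (b n) (u n) (u (suc n))) where

    -- Between two positions with the same move count the path only stutters.
    -- (The count equation is taken after the case split on b n, which unfolds it.)
    constant-≤′ : ∀ {m n} → m ≤′ n → moves b n ≡ moves b m → u n ≡ u m
    constant-≤′ ≤′-refl _ = refl
    constant-≤′ {m} (≤′-step {n} m≤′n) with b n | stutters n
    ... | true  | _      = λ same →
      ⊥-elim (1+n≰n (subst (_≤ moves b n) (sym same) (moves-mono b m≤′n)))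
    ... | false | u-same = λ same → trans u-same (constant-≤′ m≤′n same)

    constant : ∀ m n → moves b m ≡ moves b n → u m ≡ u n
    constant m n same with ≤-total m n
    ... | inj₁ m≤n = sym (constant-≤′ (≤⇒≤′ m≤n) (sym same))
    ... | inj₂ n≤m = constant-≤′ (≤⇒≤′ n≤m) same

    lastMove : ∀ m k → moves b m ≡ suc k →
               ∃ λ n → moves b n ≡ k × b n ≡ true × u n ⇒ u (suc n)
    lastMove zero    k ()
    lastMove (suc m) k with b m in moved | stutters m
    ... | true  | move = λ reached → m , suc-injective reached , moved , move
    ... | false | _    = lastMove m k

    -- The destuttered path: q k is the state of u while its move count is k.
    q : ℕ → A
    q zero = u 0
    q (suc k) with em {∃ λ m → moves b m ≡ suc k}
    ... | yes (m , _) = u m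
    ... | no _        = proj₁ (serial (q k))

    q-sample : ∀ k n → moves b n ≡ k → q k ≡ u n
    q-sample zero    n at = constant 0 n (sym at)
    q-sample (suc k) n at with em {∃ λ m → moves b m ≡ suc k}
    ... | yes (m , at′) = constant m n (trans at′ (sym at))
    ... | no never      = ⊥-elim (never (n , at))

    q-path : ∀ k → q k ⇒ q (suc k)
    q-path k with em {∃ λ m → moves b m ≡ suc k}
    ... | no _        = proj₂ (serial (q k))
    ... | yes (m , at) with lastMove m k at
    ...   | n , atₙ , moved , move =
      subst₂ _⇒_ (sym (q-sample k n atₙ))
        (constant (suc n) m (trans (moves-advance b moved) (trans (cong suc atₙ) (sym at)))) move

  destutter : ExcludedMiddle 0ℓ → (∀ a → ∃ λ a' → a ⇒ a') →
              ∀ (b : ℕ → Bool) (u : ℕ → A) → (∀ n → StutterStep (b n) (u n) (u (suc n))) →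
              ∃ λ (q : ℕ → A) → (∀ k → q k ⇒ q (suc k)) × (∀ n → q (moves b n) ≡ u n)
  destutter em serial b u stutters = q , q-path , λ n → q-sample (moves b n) n refl
    where open Destutter em serial b u stutters

module Transitions (K : Kripke) where
  open Kripke K
  open Embedding K
  open Stuttering _⟶_

  state : S' → S
  state (inj₁ x) = x
  state (inj₂ x) = x

  place : S' → S → S'
  place (inj₁ _) z = inj₁ z
  place (inj₂ _) z = inj₂ z

  -- A transition between two unbarred states follows a K-edge; all others
  -- keep the underlying K-state.
  isKStep : S' → S' → Bool
  isKStep (inj₁ _) (inj₁ _) = true
  isKStep _        _        = false

  step-stutters : ∀ {x a y} → Step x a y → StutterStep (isKStep x y) (state x) (state y)
  step-stutters (to-bar _)    = refl
  step-stutters (from-bar _)  = refl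
  step-stutters (silent e _)  = e
  step-stutters (visible e _) = e

  -- lts(K) sees K-states only through labels and edges: a transition can be
  -- replayed on other K-states with the same labels that follow the same
  -- stuttering step, with the same action.
  step-transfer : ∀ {x a y z z'} → Step x a y → L z ≡ L (state x) → L z' ≡ L (state y) →
                  StutterStep (isKStep x y) z z' → Step (place x z) a (place y z')
  step-transfer (to-bar _)     _  _  refl = to-bar _
  step-transfer (from-bar _)   lz _  refl = subst (λ l → Step _ (act (lab l)) _) lz (from-bar _)
  step-transfer (silent _ eq)  lz lz' e   = silent e (trans lz (trans eq (sym lz')))
  step-transfer (visible _ ne) lz lz' e   =
    subst (λ l → Step _ (act (lab l)) _) lz' (visible e (λ same → ne (trans (sym lz) (trans same lz'))))

  edgeAction : (a b : Subset AP) → Dec (a ≡ b) → Act⁺ (KAct AP)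
  edgeAction a b (yes _) = τ
  edgeAction a b (no _)  = act (lab b)

  Labelled : S' → Subset AP → Set
  Labelled (inj₁ x) a = L x ≡ a
  Labelled (inj₂ _) _ = ⊥

  edgeStep : ∀ {x y a b} → x ⟶ y → L x ≡ a → L y ≡ b → (d : Dec (a ≡ b)) →
             Step (inj₁ x) (edgeAction a b d) (inj₁ y)
  edgeStep e refl refl (yes same) = silent e same
  edgeStep e refl refl (no differ) = visible e differ

  edgeStep⁻¹ : ∀ {z z' a b} (d : Dec (a ≡ b)) → Labelled z a → Step z (edgeAction a b d) z' →
               Labelled z' b × state z ⟶ state z'
  edgeStep⁻¹ {inj₁ _} (yes same) refl (silent e lz) = trans (sym lz) same , e
  edgeStep⁻¹ {inj₁ _} (no _)     refl (visible e _) = refl , e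

  enter : ∀ {x a} → L x ≡ a → Step (inj₂ x) (act (lab a)) (inj₁ x)
  enter refl = from-bar _

  leave⁻¹ : ∀ {z z' x} → z ≡ inj₁ x → Step z (act ⊥act) z' → z' ≡ inj₂ x
  leave⁻¹ refl (to-bar _) = refl

  enter⁻¹ : ∀ {z z' x a} → z ≡ inj₂ x → Step z (act (lab a)) z' → Labelled z' a × state z' ≡ x
  enter⁻¹ refl (from-bar _) = refl , refl

  labelled-state : ∀ {z a} → Labelled z a → L (state z) ≡ a
  labelled-state {inj₁ _} l = l

-- Comparing traces of K with run traces of lts(K).  Excluded middle decides
-- equality of labels and destutters runs.
module Traces (em : ExcludedMiddle 0ℓ) (K : Kripke) where
  open Kripke K
  open Embedding K
  open Stuttering _⟶_
  open Transitions K

  -- The run trace of lts(K) that encodes the K-trace σ: the detour through the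
  -- barred state shows the initial label, then each edge shows its action.
  encode : (ℕ → Subset AP) → ℕ → Act⁺ (KAct AP)
  encode σ zero          = act ⊥act
  encode σ (suc zero)    = act (lab (σ 0))
  encode σ (suc (suc n)) = edgeAction (σ n) (σ (suc n)) em

  trace⇒runTrace : ∀ {x σ} → IsTrace K x σ → IsRunTrace (lts K) (inj₁ x) (encode σ)
  trace⇒runTrace {σ = σ} (q , (refl , path) , labels) = run , refl , steps
    where
    run : ℕ → S'
    run zero          = inj₁ (q 0)
    run (suc zero)    = inj₂ (q 0)
    run (suc (suc n)) = inj₁ (q n)

    steps : ∀ i → Step (run i) (encode σ i) (run (suc i))
    steps zero          = to-bar _
    steps (suc zero)    = enter (labels 0)
    steps (suc (suc n)) = edgeStep (path n) (labels n) (labels (suc n)) em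

  runTrace⇒trace : ∀ {x σ} → IsRunTrace (lts K) (inj₁ x) (encode σ) → IsTrace K x σ
  runTrace⇒trace {x} {σ} (run , start , steps) =
    (λ n → state (run (2 + n))) , (proj₂ entered , path) , λ n → labelled-state (inside n)
    where
    entered : Labelled (run 2) (σ 0) × state (run 2) ≡ x
    entered = enter⁻¹ (leave⁻¹ start (steps 0)) (steps 1)

    inside : ∀ n → Labelled (run (2 + n)) (σ n)
    inside zero    = proj₁ entered
    inside (suc n) = proj₁ (edgeStep⁻¹ em (inside n) (steps (2 + n)))

    path : ∀ n → state (run (2 + n)) ⟶ state (run (2 + suc n))
    path n = proj₂ (edgeStep⁻¹ em (inside n) (steps (2 + n)))

  kSteps : (ℕ → S') → ℕ → Bool
  kSteps run n = isKStep (run n) (run (suc n))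

  -- Trace inclusion implies completed trace inclusion: destutter the run into a
  -- K-path, take a K-path from s' with the same labels, and replay the run on it
  -- in the same stuttering pattern.
  runTraces⊆ : ∀ {s s'} → (∀ σ → IsTrace K s σ → IsTrace K s' σ) →
               ∀ ρ → IsRunTrace (lts K) (inj₁ s) ρ → IsRunTrace (lts K) (inj₁ s') ρ
  runTraces⊆ {s} {s'} traces⊆ ρ (run , start , steps)
    with destutter em total (kSteps run) (state ∘ run) (λ n → step-stutters (steps n))
  ... | q , q-path , q-sample
    with traces⊆ (L ∘ q) (q , (trans (q-sample 0) (cong state start) , q-path) , λ _ → refl)
  ... | q' , (q'-start , q'-path) , q'-labels = run' , start' , steps'
    where
    labels : ∀ n → L (q' (moves (kSteps run) n)) ≡ L (state (run n))
    labels n = trans (q'-labels (moves (kSteps run) n)) (cong L (q-sample n))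

    run' : ℕ → S'
    run' n = place (run n) (q' (moves (kSteps run) n))

    start' : run' 0 ≡ inj₁ s'
    start' = trans (cong (λ z → place z (q' 0)) start) (cong inj₁ q'-start)

    steps' : ∀ n → Step (run' n) (ρ n) (run' (suc n))
    steps' n = step-transfer (steps n) (labels n) (labels (suc n)) (sample q'-path (kSteps run) n)

  traces⊆ : ∀ {s s'} → (∀ ρ → IsRunTrace (lts K) (inj₁ s) ρ → IsRunTrace (lts K) (inj₁ s') ρ) →
            ∀ σ → IsTrace K s σ → IsTrace K s' σ
  traces⊆ runTraces⊆ σ t = runTrace⇒trace (runTraces⊆ (encode σ) (trace⇒runTrace t))

-- Theorem 3.19.  Both equivalences are two-sided inclusions, and each kind of
-- inclusion implies the other.
theorem3p19 : ExcludedMiddle 0ℓ → Extensionality 0ℓ 0ℓ →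
    (K : Kripke) → (s s' : Kripke.S K) →
    TraceEquivalent K s s' ⇔ CompletedTraceEquivalent (lts K) (inj₁ s) (inj₁ s')
theorem3p19 em _ K s s' = mk⇔
  (λ same ρ → mk⇔ (runTraces⊆ (Equivalence.to ∘ same) ρ) (runTraces⊆ (Equivalence.from ∘ same) ρ))
  (λ same σ → mk⇔ (traces⊆ (Equivalence.to ∘ same) σ) (traces⊆ (Equivalence.from ∘ same) σ))
  where open Traces em K
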